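{- Let $n\ge 3$ and let $\prec$ be a uniform linear ordering of $[k]^n$ whose induced ordering on $[k]$ (the common restriction to all $1$-subcubes) is the usual ordering $<$ of $[k]$. Define the relation $\preceq$ on pairs $a<b$ of $[k]$ (written $[a,b]$) by $[a,b]\preceq[c,d]$ iff $cb\prec da$, where $cb,da\in[k]^2$ are compared using the common restriction of $\prec$ to $2$-subcubes. Then $\preceq$ is tree-like.
   Context: Elements of $[k]^n$ are words over $[k]=\{1,\dotsc,k\}$. A $d$-parameter word of length $n$ is a word $p$ over $[k]\cup\{*_1,\dotsc,*_d\}$ containing each $*_i$; $p[w]$ replaces each $*_i$ by $w_i$; $\{p[w]:w\in[k]^d\}$ is a $d$-subcube. Canonical words have first occurrences of $*_1,\dotsc,*_d$ in order; each subcube has a unique canonical word, giving the canonical bijection. The restriction of $\prec$ to a subcube is the ordering of $[k]^d$ with $w\prec w'$ iff $p[w]\prec p[w']$; $\prec$ is uniform if for each $d$ all restrictions to $d$-subcubes coincide. A nontrivial subinterval of $[k]$ is $[a,b]=\{a,\dotsc,b\}$ with $a<b$. Write $[a,b]\approx[c,d]$ if $[a,b]\preceq[c,d]$ and $[c,d]\preceq[a,b]$. A relation $\preceq$ on nontrivial subintervals of $[k]$ is tree-like if: (1) transitivity: $[a,b]\preceq[c,d]$ and $[c,d]\preceq[e,f]$ imply $[a,b]\preceq[e,f]$; (2) comparability: $[a,b]\preceq[c,d]$ or $[c,d]\preceq[a,b]$; (3) ultrametric property: if $a<b<c$ then $[a,c]\approx\max([a,b],[b,c])$, where the max is with respect to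 $\preceq$. -}

module Defs where

open import Data.Nat using (ℕ; zero; suc)
open import Data.Fin using (Fin; _<_; zero; suc)
open import Data.Vec using (Vec; map; lookup; _∷_; [])
open import Data.Vec.Membership.Propositional using (_∈_)
open import Data.Sum using (_⊎_; inj₁; inj₂; [_,_])
open import Data.Product using (Σ; ∃; _×_; _,_)
open import Function using (id)
open import Relation.Binary.PropositionalEquality using (_≡_)
open import Relation.Binary.Definitions using (Transitive)

-- Words of length n over [k] = {1,…,k}; the letter i+1 is represented by i : Fin k,
-- so the usual order on [k] is Data.Fin._<_.
Word : ℕ → ℕ → Set
Word k n = Vec (Fin k) n

-- Letters of a d-parameter word: inj₁ a is the letter a, inj₂ i is the variable *_(i+1).
Letter : ℕ → ℕ → Set
Letter k d = Fin k ⊎ Fin d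

record ParamWord (k d n : ℕ) : Set where
  constructor pw
  field
    letters  : Vec (Letter k d) n
    contains : ∀ (i : Fin d) → inj₂ i ∈ letters
open ParamWord public

subst : ∀ {k d n} → ParamWord k d n → Word k d → Word k n
subst p w = map [ id , (λ i → lookup w i) ] (letters p)

-- Canonical: first occurrences of *_1,…,*_d are in order, i.e. whenever i < j,
-- every occurrence of *_j is preceded by some occurrence of *_i.
Canonical : ∀ {k d n} → ParamWord k d n → Set
Canonical {k} {d} {n} p =
  ∀ (i j : Fin d) → i < j → ∀ (m : Fin n) → lookup (letters p) m ≡ inj₂ j →
    ∃ λ (m' : Fin n) → (m' < m) × (lookup (letters p) m' ≡ inj₂ i)

-- Restriction of ≺ to the subcube with canonical word p (via the canonical bijection).
Restrict : ∀ {k d n} → (Word k n → Word k n → Set) → ParamWord k d n →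
           Word k d → Word k d → Set
Restrict _≺_ p w w' = subst p w ≺ subst p w'

_↔_ : Set → Set → Set
A ↔ B = (A → B) × (B → A)

Uniform : ∀ {k n} → (Word k n → Word k n → Set) → Set
Uniform {k} {n} _≺_ =
  ∀ (d : ℕ) (p q : ParamWord k d n) → Canonical p → Canonical q →
    ∀ (w w' : Word k d) → Restrict _≺_ p w w' ↔ Restrict _≺_ q w w'

InducesUsualOrder : ∀ {k n} → (Word k n → Word k n → Set) → Set
InducesUsualOrder {k} {n} _≺_ =
  ∀ (p : ParamWord k 1 n) → Canonical p →
    ∀ (a b : Fin k) → Restrict _≺_ p (a ∷ []) (b ∷ []) ↔ (a < b)

record Interval (k : ℕ) : Set where
  constructor ⟦_,_⟧⟨_⟩
  field
    lo hi : Fin k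
    lo<hi : lo < hi
open Interval public

module _ {k : ℕ} (_≼_ : Interval k → Interval k → Set) where

  _≈ᵢ_ : Interval k → Interval k → Set
  I ≈ᵢ J = (I ≼ J) × (J ≼ I)

  -- [a,c] ≈ max([a,b],[b,c]) w.r.t. ≼ (max determined up to ≈ by the larger one).
  ≈Max : Interval k → Interval k → Interval k → Set
  ≈Max K I J = (I ≼ J → K ≈ᵢ J) × (J ≼ I → K ≈ᵢ I)

  record TreeLike : Set where
    field
      trans       : ∀ {I J K} → I ≼ J → J ≼ K → I ≼ K
      comparable  : ∀ I J → (I ≼ J) ⊎ (J ≼ I)
      ultrametric : ∀ (a b c : Fin k) (a<b : a < b) (b<c : b < c) (a<c : a < c) →
                    ≈Max ⟦ a , c ⟧⟨ a<c ⟩ ⟦ a , b ⟧⟨ a<b ⟩ ⟦ b , c ⟧⟨ b<c ⟩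

-- [a,b] ≼ [c,d] iff cb ≺₂ da, using the restriction of ≺ to the 2-subcube with
-- canonical word p (all such restrictions coincide when ≺ is uniform).
IntervalRel : ∀ {k n} → (Word k n → Word k n → Set) → ParamWord k 2 n →
              Interval k → Interval k → Set
IntervalRel _≺_ p I J =
  Restrict _≺_ p (lo J ∷ hi I ∷ []) (hi J ∷ lo I ∷ [])

module Submission where

-- Let T be the common ordering of [k]² induced on 2-subcubes and
-- write xyz for the word x y z z … z of length n = 3 + m.  Every canonical
-- 2-parameter word of the shape l₁ l₂ l₃ l₃ … l₃ embeds T into ≺ on such words:
-- e.g. *₁*₂z gives  T(xy, x'y') ⇔ xyz ≺ x'y'z, and z*₁*₂, *₁z*₂, *₁*₂*₁, *₁*₂*₂
-- give analogous transfers; the 1-parameter word *₁yz turns the induced order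
-- on [k] into ayz ≺ byz for a < b.  Since *₁*₂*₂ is injective, T is moreover
-- total on pairs with distinct first letters.

open import Defs
open import Data.Nat using (ℕ; _≥_; _+_; s≤s; z≤n)
open import Data.Vec using (Vec; _∷_; []; replicate; head; lookup)
open import Data.Vec.Properties using (map-replicate)
open import Data.Vec.Relation.Unary.Any using (here; there)
open import Data.Vec.Membership.Propositional using (_∈_)
open import Data.Fin using (Fin; zero; suc) renaming (_<_ to _<ᶠ_)
open import Data.Fin.Properties using (<⇒≢)
open import Data.Sum using (_⊎_; inj₁; inj₂; [_,_])
open import Data.Product using (_,_; proj₁; proj₂)
open import Data.Empty using (⊥; ⊥-elim)
open import Function using (id)
open import Relation.Binary.PropositionalEquality
  using (_≡_; _≢_; refl; cong; sym) renaming (subst₂ to ≡-subst₂)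
open import Relation.Binary.Structures using (IsStrictPartialOrder; IsStrictTotalOrder)
open import Relation.Binary.Definitions using (tri<; tri≈; tri>)

-- How an ordering T of pairs ("xy before x'y'", written T x y x' y') embeds
-- into an ordering ⊏ of three-letter words W x y z.
record Embeds {k : ℕ} {A : Set} (_⊏_ : A → A → Set) (W : Fin k → Fin k → Fin k → A)
              (T : Fin k → Fin k → Fin k → Fin k → Set) : Set where
  field
    total        : ∀ {x y x' y'} → x ≢ x' → T x y x' y' ⊎ T x' y' x y
    pattern12z   : ∀ z {x y x' y'} → T x y x' y' → W x y z ⊏ W x' y' z
    patternz12   : ∀ z {x y x' y'} → T x y x' y' → W z x y ⊏ W z x' y'
    pattern1z2   : ∀ z {x y x' y'} → T x y x' y' → W x z y ⊏ W x' z y'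
    pattern121   : ∀ {x y x' y'} → T x y x' y' → W x y x ⊏ W x' y' x'
    pattern122   : ∀ {x y x' y'} → T x y x' y' → W x y y ⊏ W x' y' y'
    pattern122⁻¹ : ∀ {x y x' y'} → W x y y ⊏ W x' y' y' → T x y x' y'
    monotone     : ∀ y z {a b} → a <ᶠ b → W a y z ⊏ W b y z

IntervalOrder : ∀ {k} → (Fin k → Fin k → Fin k → Fin k → Set) →
                Interval k → Interval k → Set
IntervalOrder T I J = T (lo J) (hi I) (hi J) (lo I)

module TreeLikeFromEmbeds {k : ℕ} {A : Set} {_⊏_ : A → A → Set}
  {W : Fin k → Fin k → Fin k → A} {T : Fin k → Fin k → Fin k → Fin k → Set}
  (⊏-strict : IsStrictPartialOrder _≡_ _⊏_) (E : Embeds _⊏_ W T) where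

  open IsStrictPartialOrder ⊏-strict using (irrefl) renaming (trans to ⊏-trans)
  open Embeds E

  _≼_ : Interval k → Interval k → Set
  _≼_ = IntervalOrder T

  -- A strict partial order has no 3-cycles; every contradiction below is one.
  no-3-cycle : ∀ {u v w} → u ⊏ v → v ⊏ w → w ⊏ u → ⊥
  no-3-cycle u⊏v v⊏w w⊏u = irrefl refl (⊏-trans (⊏-trans u⊏v v⊏w) w⊏u)

  total-< : ∀ {x x'} y y' → x <ᶠ x' → T x y x' y' ⊎ T x' y' x y
  total-< _ _ x<x' = total (<⇒≢ x<x')

  -- For a < b the pair ab comes before ba: the reverse would give the cycle
  -- bab ⊏ aba ⊏ aab ⊏ bab.
  swap : ∀ {a b} → a <ᶠ b → T a b b a
  swap {a} {b} a<b with total-< b a a<b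
  ... | inj₁ ab<ba = ab<ba
  ... | inj₂ ba<ab = ⊥-elim (no-3-cycle (pattern121 ba<ab) (patternz12 a ba<ab) (monotone a b a<b))

  comparable : ∀ I J → (I ≼ J) ⊎ (J ≼ I)
  comparable ⟦ a , b ⟧⟨ a<b ⟩ ⟦ c , d ⟧⟨ c<d ⟩ with total-< b a c<d
  ... | inj₁ I≼J = inj₁ I≼J
  ... | inj₂ da<cb with total-< d c a<b
  ...   | inj₁ J≼I = inj₂ J≼I
  ...   | inj₂ bc<ad =
          ⊥-elim (no-3-cycle (patternz12 b da<cb) (pattern121 bc<ad) (monotone d a a<b))

  transitive : ∀ {I J K} → I ≼ J → J ≼ K → I ≼ K
  transitive {⟦ a , b ⟧⟨ _ ⟩} {⟦ c , d ⟧⟨ _ ⟩} {⟦ e , f ⟧⟨ e<f ⟩} I≼J J≼K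
    with total-< b a e<f
  ... | inj₁ I≼K = I≼K
  ... | inj₂ fa<eb =
        ⊥-elim (no-3-cycle (patternz12 e I≼J) (pattern12z a J≼K) (pattern1z2 c fa<eb))

  module _ {a b c : Fin k} (a<b : a <ᶠ b) (b<c : b <ᶠ c) (a<c : a <ᶠ c) where

    I J K : Interval k
    I = ⟦ a , b ⟧⟨ a<b ⟩
    J = ⟦ b , c ⟧⟨ b<c ⟩
    K = ⟦ a , c ⟧⟨ a<c ⟩

    -- Each part lies below the whole interval: abb ⊏ baa ⊏ caa and acc ⊏ bcc ⊏ cbb.
    left-below-whole : I ≼ K
    left-below-whole =
      pattern122⁻¹ (⊏-trans (pattern122 (swap a<b)) (monotone a a b<c))

    right-below-whole : J ≼ K
    right-below-whole =
      pattern122⁻¹ (⊏-trans (monotone c c a<b) (pattern122 (swap b<c)))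

    -- The whole interval lies below one of its parts; otherwise
    -- caa ⊏ bca ⊏ acc ⊏ caa.
    whole-below-part : (K ≼ I) ⊎ (K ≼ J)
    whole-below-part with total-< c a a<b
    ... | inj₁ K≼I = inj₁ K≼I
    ... | inj₂ ba<ac with total-< c a b<c
    ...   | inj₁ K≼J = inj₂ K≼J
    ...   | inj₂ ca<bc =
            ⊥-elim (no-3-cycle (pattern12z a ca<bc) (pattern1z2 c ba<ac) (pattern122 (swap a<c)))

    ultrametric : ≈Max _≼_ K I J
    ultrametric = (λ I≼J → below-larger I≼J , right-below-whole)
                , (λ J≼I → below-larger' J≼I , left-below-whole)
      where
      below-larger : I ≼ J → K ≼ J
      below-larger I≼J with whole-below-part
      ... | inj₁ K≼I = transitive {K} {I} {J} K≼I I≼J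
      ... | inj₂ K≼J = K≼J

      below-larger' : J ≼ I → K ≼ I
      below-larger' J≼I with whole-below-part
      ... | inj₁ K≼I = K≼I
      ... | inj₂ K≼J = transitive {K} {J} {I} K≼J J≼I

  tree-like : TreeLike _≼_
  tree-like = record
    { trans       = λ {I} {J} {K} → transitive {I} {J} {K}
    ; comparable  = comparable
    ; ultrametric = λ _ _ _ → ultrametric
    }

canonical-1 : ∀ {k n} (q : ParamWord k 1 n) → Canonical q
canonical-1 q zero zero () _ _

canonical-*₁-first : ∀ {k n} (rest : Vec (Letter k 2) n) c →
                     Canonical (pw (inj₂ zero ∷ rest) c)
canonical-*₁-first rest c zero (suc zero) _ (suc _) _ = zero , s≤s z≤n , refl
canonical-*₁-first rest c zero (suc zero) _ zero ()
canonical-*₁-first rest c (suc zero) (suc zero) (s≤s ()) _ _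

canonical-*₁-second : ∀ {k n} z (rest : Vec (Letter k 2) n) c →
                      Canonical (pw (inj₁ z ∷ inj₂ zero ∷ rest) c)
canonical-*₁-second z rest c zero (suc zero) _ (suc (suc _)) _ = suc zero , s≤s (s≤s z≤n) , refl
canonical-*₁-second z rest c zero (suc zero) _ (suc zero) ()
canonical-*₁-second z rest c zero (suc zero) _ zero ()
canonical-*₁-second z rest c (suc zero) (suc zero) (s≤s ()) _ _

module ThreeLetterWords {k : ℕ} (m : ℕ) where

  W : Fin k → Fin k → Fin k → Word k (3 + m)
  W x y z = x ∷ y ∷ z ∷ replicate m z

  template : ∀ {d} → Letter k d → Letter k d → Letter k d → Vec (Letter k d) (3 + m)
  template l₁ l₂ l₃ = l₁ ∷ l₂ ∷ l₃ ∷ replicate m l₃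

  fill : ∀ {d} → Word k d → Letter k d → Fin k
  fill w = [ id , lookup w ]

  W-injective₁ : ∀ {x y z x' y' z'} → W x y z ≡ W x' y' z' → x ≡ x'
  W-injective₁ = cong head

  subst-template : ∀ {d} l₁ l₂ l₃ c (w : Word k d) →
                   subst (pw (template l₁ l₂ l₃) c) w ≡ W (fill w l₁) (fill w l₂) (fill w l₃)
  subst-template l₁ l₂ l₃ c w =
    cong (λ v → fill w l₁ ∷ fill w l₂ ∷ fill w l₃ ∷ v) (map-replicate (fill w) l₃ m)

module EmbeddingsFromUniformity (k m : ℕ) (_≺_ : Word k (3 + m) → Word k (3 + m) → Set)
  (≺-sto : IsStrictTotalOrder _≡_ _≺_) (uniform : Uniform _≺_) (usual : InducesUsualOrder _≺_)
  (p : ParamWord k 2 (3 + m)) (p-canonical : Canonical p) where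

  open ThreeLetterWords {k} m
  open IsStrictTotalOrder ≺-sto using (compare)

  T : Fin k → Fin k → Fin k → Fin k → Set
  T x y x' y' = Restrict _≺_ p (x ∷ y ∷ []) (x' ∷ y' ∷ [])

  *₁ *₂ : Letter k 2
  *₁ = inj₂ zero
  *₂ = inj₂ (suc zero)

  via : ∀ l₁ l₂ l₃ c → Canonical (pw (template l₁ l₂ l₃) c) → ∀ {x y x' y'} →
        let f = fill (x ∷ y ∷ []) ; f' = fill (x' ∷ y' ∷ []) in
        T x y x' y' ↔ (W (f l₁) (f l₂) (f l₃) ≺ W (f' l₁) (f' l₂) (f' l₃))
  via l₁ l₂ l₃ c q-canonical {x} {y} {x'} {y'} =
      (λ t → ≡-subst₂ _≺_ (subst-template l₁ l₂ l₃ c w) (subst-template l₁ l₂ l₃ c w')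
                           (proj₁ transfer t))
    , (λ t → proj₂ transfer (≡-subst₂ _≺_ (sym (subst-template l₁ l₂ l₃ c w))
                                          (sym (subst-template l₁ l₂ l₃ c w')) t))
    where
    w w' : Word k 2
    w = x ∷ y ∷ []
    w' = x' ∷ y' ∷ []
    transfer : Restrict _≺_ p w w' ↔ Restrict _≺_ (pw (template l₁ l₂ l₃) c) w w'
    transfer = uniform 2 p (pw (template l₁ l₂ l₃) c) p-canonical q-canonical w w'

  via-12z : ∀ z {x y x' y'} → T x y x' y' ↔ (W x y z ≺ W x' y' z)
  via-12z z = via *₁ *₂ (inj₁ z) c (canonical-*₁-first _ c)
    where
    c : ∀ i → inj₂ i ∈ template *₁ *₂ (inj₁ z)
    c zero = here refl
    c (suc zero) = there (here refl)

  via-z12 : ∀ z {x y x' y'} → T x y x' y' ↔ (W z x y ≺ W z x' y')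
  via-z12 z = via (inj₁ z) *₁ *₂ c (canonical-*₁-second z _ c)
    where
    c : ∀ i → inj₂ i ∈ template (inj₁ z) *₁ *₂
    c zero = there (here refl)
    c (suc zero) = there (there (here refl))

  via-1z2 : ∀ z {x y x' y'} → T x y x' y' ↔ (W x z y ≺ W x' z y')
  via-1z2 z = via *₁ (inj₁ z) *₂ c (canonical-*₁-first _ c)
    where
    c : ∀ i → inj₂ i ∈ template *₁ (inj₁ z) *₂
    c zero = here refl
    c (suc zero) = there (there (here refl))

  via-121 : ∀ {x y x' y'} → T x y x' y' ↔ (W x y x ≺ W x' y' x')
  via-121 = via *₁ *₂ *₁ c (canonical-*₁-first _ c)
    where
    c : ∀ i → inj₂ i ∈ template *₁ *₂ *₁
    c zero = here refl
    c (suc zero) = there (here refl)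

  via-122 : ∀ {x y x' y'} → T x y x' y' ↔ (W x y y ≺ W x' y' y')
  via-122 = via *₁ *₂ *₂ c (canonical-*₁-first _ c)
    where
    c : ∀ i → inj₂ i ∈ template *₁ *₂ *₂
    c zero = here refl
    c (suc zero) = there (here refl)

  monotone : ∀ y z {a b} → a <ᶠ b → W a y z ≺ W b y z
  monotone y z {a} {b} a<b =
    ≡-subst₂ _≺_ (subst-template *₁′ (inj₁ y) (inj₁ z) c (a ∷ []))
                 (subst-template *₁′ (inj₁ y) (inj₁ z) c (b ∷ []))
                 (proj₂ (usual q (canonical-1 q) a b) a<b)
    where
    *₁′ : Letter k 1
    *₁′ = inj₂ zero
    c : ∀ i → inj₂ i ∈ template *₁′ (inj₁ y) (inj₁ z)
    c zero = here refl
    q : ParamWord k 1 (3 + m)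
    q = pw (template *₁′ (inj₁ y) (inj₁ z)) c

  -- T compares xy and x'y' through xyy and x'y'y', so it is total when x ≢ x'.
  total : ∀ {x y x' y'} → x ≢ x' → T x y x' y' ⊎ T x' y' x y
  total {x} {y} {x'} {y'} x≢x' with compare (W x y y) (W x' y' y')
  ... | tri< lt _ _ = inj₁ (proj₂ via-122 lt)
  ... | tri≈ _ eq _ = ⊥-elim (x≢x' (W-injective₁ eq))
  ... | tri> _ _ gt = inj₂ (proj₂ via-122 gt)

  embeds : Embeds _≺_ W T
  embeds = record
    { total        = total
    ; pattern12z   = λ z → proj₁ (via-12z z)
    ; patternz12   = λ z → proj₁ (via-z12 z)
    ; pattern1z2   = λ z → proj₁ (via-1z2 z)
    ; pattern121   = proj₁ via-121
    ; pattern122   = proj₁ via-122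
    ; pattern122⁻¹ = proj₂ via-122
    ; monotone     = monotone
    }

lemma9 : ∀ (k n : ℕ) → n ≥ 3 →
    (_≺_ : Word k n → Word k n → Set) →
    IsStrictTotalOrder _≡_ _≺_ →
    Uniform _≺_ →
    InducesUsualOrder _≺_ →
    ∀ (p : ParamWord k 2 n) → Canonical p →
    TreeLike (IntervalRel _≺_ p)
lemma9 k _ (s≤s (s≤s (s≤s (z≤n {m})))) _≺_ ≺-sto uniform usual p p-canonical =
  TreeLikeFromEmbeds.tree-like (IsStrictTotalOrder.isStrictPartialOrder ≺-sto)
    (EmbeddingsFromUniformity.embeds k m _≺_ ≺-sto uniform usual p p-canonical)
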